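{- Let $B\subseteq F(2^{\mathbb{Z}^2})$ be a Borel complete section. Then there is an $x\in F(2^{\mathbb{Z}^2})$, a $k\in\mathbb{Z}^2$ and positive integers $w,h$ such that, with $L=k+\{(iw,jh):(i,j)\in\mathbb{Z}^2\}$, we have $L\cdot x\subseteq B$.
   Context: $\mathbb{Z}^2$ acts on $2^{\mathbb{Z}^2}$ by the Bernoulli shift $(g\cdot x)(h)=x(h-g)$; $F(2^{\mathbb{Z}^2})$ is the set of $x$ with $g\cdot x\neq x$ for all $g\neq(0,0)$. A complete section is a subset of $F(2^{\mathbb{Z}^2})$ meeting every orbit. $L\cdot x=\{g\cdot x:g\in L\}$. -}

module Defs where

open import Data.Bool using (Bool)
open import Data.Nat using (ℕ; suc)
open import Data.Integer as ℤ using (ℤ; +_; 0ℤ)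
open import Data.Product using (_×_; _,_; Σ; ∃)
open import Data.Sum using (_⊎_)
open import Relation.Nullary using (¬_)
open import Relation.Binary.PropositionalEquality using (_≡_; _≢_)

ℤ² : Set
ℤ² = ℤ × ℤ

_⊕_ : ℤ² → ℤ² → ℤ²
(a , b) ⊕ (c , d) = (a ℤ.+ c , b ℤ.+ d)

_⊖_ : ℤ² → ℤ² → ℤ²
(a , b) ⊖ (c , d) = (a ℤ.- c , b ℤ.- d)

origin : ℤ²
origin = (0ℤ , 0ℤ)

Point : Set
Point = ℤ² → Bool

_·_ : ℤ² → Point → Point
(g · x) h = x (h ⊖ g)

-- x ∈ F(2^{ℤ²}) : g · x ≠ x for every g ≠ 0 (equality of points = pointwise equality)
Free : Point → Set
Free x = ∀ (g : ℤ²) → g ≢ origin → ¬ (∀ (h : ℤ²) → (g · x) h ≡ x h)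

-- Borel codes: the σ-algebra generated by the subbasic clopen cylinders {x | x h = b}
data BorelCode : Set where
  cyl   : ℤ² → Bool → BorelCode
  compl : BorelCode → BorelCode
  union : (ℕ → BorelCode) → BorelCode

⟦_⟧ : BorelCode → Point → Set
⟦ cyl h b ⟧ x = x h ≡ b
⟦ compl c ⟧ x = ¬ (⟦ c ⟧ x)
⟦ union f ⟧ x = ∃ λ n → ⟦ f n ⟧ x

IsBorel : (Point → Set) → Set
IsBorel B = Σ BorelCode λ c → ∀ x → (B x → ⟦ c ⟧ x) × (⟦ c ⟧ x → B x)

CompleteSection : (Point → Set) → Set
CompleteSection B =
  (∀ x → B x → Free x) × (∀ x → Free x → ∃ λ (g : ℤ²) → B (g · x))

ExcludedMiddle : Set₁
ExcludedMiddle = ∀ (P : Set) → P ⊎ ¬ P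

latticePt : ℤ² → ℕ → ℕ → ℤ → ℤ → ℤ²
latticePt k w h i j = k ⊕ (i ℤ.* + w , j ℤ.* + h)

module Submission where

-- A forcing argument. Conditions are partial 2-colourings of ℤ² that are periodic along a rectangular
-- lattice and leave some cell uncoloured. A point x meeting countably many dense sets of conditions
-- (deciding each subcode of the Borel code of B at each translate, colouring each cell, breaking each
-- translation) is free, and g · x lies in B exactly when some condition along x forces it. Since B meets
-- the orbit of x, some such condition p forces g · x ∈ B; as p is invariant under its own lattice, it
-- forces the same at every lattice translate of g.

open import Defs
open import Data.Nat using (ℕ; zero; suc)
open import Data.Integer using (ℤ)
open import Data.Product using (_×_; _,_; Σ)

open import Data.Bool using (Bool; true; false; not)
open import Data.Bool.Properties using (not-¬)
open import Data.Empty using (⊥-elim)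
open import Data.Integer using (+_; -[1+_]; -_; _+_; _-_; _*_; 0ℤ; ∣_∣)
import Data.Integer.Properties as ℤ
open import Data.Integer.Divisibility.Signed
  using (_∣_; divides; ∣-refl; ∣-trans; ∣m∣n⇒∣m+n; ∣m⇒∣-m; ∣n⇒∣m*n; ∣⇒∣ᵤ; _∣?_)
open import Data.Integer.Tactic.RingSolver using (solve-∀)
open import Data.List using (List; []; _∷_; length)
open import Data.Maybe using (Maybe; just; nothing)
open import Data.Maybe.Properties using (just-injective)
import Data.Nat as ℕ
import Data.Nat.Properties as ℕ
open import Data.Nat.Divisibility using (>⇒∤)
open import Data.Product using (∃; proj₁; proj₂; uncurry)
open import Data.Product.Properties using (≡-dec)
open import Data.Sum using (_⊎_; inj₁; inj₂)
open import Function using (_∘_; _⇔_; mk⇔; Equivalence)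
open import Relation.Nullary using (¬_; Dec; yes; no; does)
open import Relation.Nullary.Decidable using (map′; _×-dec_; does-⇔; dec-true; dec-false)
open import Relation.Binary.PropositionalEquality

private
  [i-k]-[j-k]≡i-j : ∀ i j k → (i - k) - (j - k) ≡ i - j
  [i-k]-[j-k]≡i-j = solve-∀

  [i-j]+[j-k]≡i-k : ∀ i j k → (i - j) + (j - k) ≡ i - k
  [i-j]+[j-k]≡i-k = solve-∀

  -[i-j]≡j-i : ∀ i j → - (i - j) ≡ j - i
  -[i-j]≡j-i = solve-∀

  i-[i-j]≡j : ∀ i j → i - (i - j) ≡ j
  i-[i-j]≡j = solve-∀

  [i+j]-j≡i : ∀ i j → (i + j) - j ≡ i
  [i+j]-j≡i = solve-∀

  [i-j]-k≡i-[j+k] : ∀ i j k → (i - j) - k ≡ i - (j + k)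
  [i-j]-k≡i-[j+k] = solve-∀

  [i-[-j]]-j≡i : ∀ i j → (i - (- j)) - j ≡ i
  [i-[-j]]-j≡i = solve-∀

  [i-j]-[-j]≡i : ∀ i j → (i - j) - (- j) ≡ i
  [i-j]-[-j]≡i = solve-∀

negate : ℤ² → ℤ²
negate (a , b) = (- a , - b)

⊕-⊖-cancel : ∀ z l → (z ⊕ l) ⊖ l ≡ z
⊕-⊖-cancel (a , b) (c , d) = cong₂ _,_ ([i+j]-j≡i a c) ([i+j]-j≡i b d)

⊖-⊖≡⊖-⊕ : ∀ z t l → (z ⊖ t) ⊖ l ≡ z ⊖ (t ⊕ l)
⊖-⊖≡⊖-⊕ (a , b) (c , d) (e , f) = cong₂ _,_ ([i-j]-k≡i-[j+k] a c e) ([i-j]-k≡i-[j+k] b d f)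

⊖-negate-⊖ : ∀ z l → (z ⊖ negate l) ⊖ l ≡ z
⊖-negate-⊖ (a , b) (c , d) = cong₂ _,_ ([i-[-j]]-j≡i a c) ([i-[-j]]-j≡i b d)

⊖-⊖-negate : ∀ z l → (z ⊖ l) ⊖ negate l ≡ z
⊖-⊖-negate (a , b) (c , d) = cong₂ _,_ ([i-j]-[-j]≡i a c) ([i-j]-[-j]≡i b d)

record Congruent (m n : ℕ) (z z′ : ℤ²) : Set where
  constructor congruent
  field
    ∣Δ₁ : + m ∣ proj₁ z - proj₁ z′
    ∣Δ₂ : + n ∣ proj₂ z - proj₂ z′

∣i-i : ∀ m i → + m ∣ i - i
∣i-i m i = divides 0ℤ (ℤ.+-inverseʳ i)

congruent-refl : ∀ {m n} z → Congruent m n z z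
congruent-refl {m} {n} (a , b) = congruent (∣i-i m a) (∣i-i n b)

congruent-sym : ∀ {m n z z′} → Congruent m n z z′ → Congruent m n z′ z
congruent-sym {m} {n} {a , b} {c , d} (congruent m∣ n∣) = congruent
  (subst (+ m ∣_) (-[i-j]≡j-i a c) (∣m⇒∣-m m∣)) (subst (+ n ∣_) (-[i-j]≡j-i b d) (∣m⇒∣-m n∣))

congruent-trans : ∀ {m n z z′ z″} → Congruent m n z z′ → Congruent m n z′ z″ → Congruent m n z z″
congruent-trans {m} {n} {a , b} {c , d} {e , f} (congruent m∣ n∣) (congruent m∣′ n∣′) = congruent
  (subst (+ m ∣_) ([i-j]+[j-k]≡i-k a c e) (∣m∣n⇒∣m+n m∣ m∣′))
  (subst (+ n ∣_) ([i-j]+[j-k]≡i-k b d f) (∣m∣n⇒∣m+n n∣ n∣′))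

congruent-⊖ : ∀ {m n z z′} l → Congruent m n z z′ → Congruent m n (z ⊖ l) (z′ ⊖ l)
congruent-⊖ {m} {n} {a , b} {c , d} (e , f) (congruent m∣ n∣) = congruent
  (subst (+ m ∣_) (sym ([i-k]-[j-k]≡i-j a c e)) m∣) (subst (+ n ∣_) (sym ([i-k]-[j-k]≡i-j b d f)) n∣)

congruent-⊖-multiple : ∀ {m n} z {g} → (+ m ∣ proj₁ g) → (+ n ∣ proj₂ g) → Congruent m n z (z ⊖ g)
congruent-⊖-multiple {m} {n} (a , b) {c , d} m∣ n∣ = congruent
  (subst (+ m ∣_) (sym (i-[i-j]≡j a c)) m∣) (subst (+ n ∣_) (sym (i-[i-j]≡j b d)) n∣)

congruent-coarsen : ∀ {m n z z′} k l → Congruent (k ℕ.* m) (l ℕ.* n) z z′ → Congruent m n z z′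
congruent-coarsen {m} {n} k l (congruent km∣ ln∣) = congruent
  (∣-trans (divides (+ k) (ℤ.pos-* k m)) km∣) (∣-trans (divides (+ l) (ℤ.pos-* l n)) ln∣)

congruent? : ∀ m n z z′ → Dec (Congruent m n z z′)
congruent? m n (a , b) (c , d) = map′ (uncurry congruent) (λ (congruent m∣ n∣) → m∣ , n∣)
  ((+ m ∣? a - c) ×-dec (+ n ∣? b - d))

∣-small⇒≡0 : ∀ {n d} → (+ n ∣ d) → ∣ d ∣ ℕ.< n → d ≡ 0ℤ
∣-small⇒≡0 {n} {d} n∣d ∣d∣<n with ∣ d ∣ in ∣d∣≡ | ∣⇒∣ᵤ n∣d
... | zero  | _    = ℤ.∣i∣≡0⇒i≡0 ∣d∣≡
... | suc _ | n∣∣d∣ = ⊥-elim (>⇒∤ ∣d∣<n n∣∣d∣)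

congruent-⊖-small : ∀ {m n} z g → Congruent m n z (z ⊖ g) →
  ∣ proj₁ g ∣ ℕ.< m → ∣ proj₂ g ∣ ℕ.< n → g ≡ origin
congruent-⊖-small (a , b) (c , d) (congruent m∣ n∣) c<m d<n =
  cong₂ _,_ (∣-small⇒≡0 (subst (_ ∣_) (i-[i-j]≡j a c) m∣) c<m)
            (∣-small⇒≡0 (subst (_ ∣_) (i-[i-j]≡j b d) n∣) d<n)

-- Periodic partial colourings

-- The hole keeps a condition from determining a periodic, hence non-free, point.
record Condition : Set where
  no-eta-equality
  field
    width height : ℕ
    value    : ℤ² → Maybe Bool
    periodic : ∀ {z z′} → Congruent (suc width) (suc height) z z′ → value z ≡ value z′
    hole     : ∃ λ a → value a ≡ nothing
open Condition

empty : Condition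
empty = record { width = 0 ; height = 0 ; value = λ _ → nothing ; periodic = λ _ → refl ; hole = origin , refl }

infix 4 _≼_

record _≼_ (q p : Condition) : Set where
  no-eta-equality
  constructor extends
  field keeps : ∀ {z b} → value p z ≡ just b → value q z ≡ just b
open _≼_

≼-refl : ∀ {p} → p ≼ p
≼-refl = extends λ e → e

≼-trans : ∀ {r q p} → r ≼ q → q ≼ p → r ≼ p
≼-trans r≼q q≼p = extends (keeps r≼q ∘ keeps q≼p)

shift : ℤ² → Condition → Condition
shift l p = record
  { width    = width p
  ; height   = height p
  ; value    = λ z → value p (z ⊖ l)
  ; periodic = λ z≡z′ → periodic p (congruent-⊖ l z≡z′)
  ; hole     = let (a , pa≡nothing) = hole p in
               a ⊕ l , trans (cong (value p) (⊕-⊖-cancel a l)) pa≡nothing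
  }

shift-mono : ∀ {l q p} → q ≼ p → shift l q ≼ shift l p
shift-mono q≼p = extends (keeps q≼p)

shift-negate-≼ : ∀ {l r} → shift l (shift (negate l) r) ≼ r
shift-negate-≼ {l} {r} = extends λ {z} e → trans (cong (value r) (⊖-⊖-negate z l)) e

≼-shift⇒shift-negate-≼ : ∀ {l r q} → r ≼ shift l q → shift (negate l) r ≼ q
≼-shift⇒shift-negate-≼ {l} {r} {q} r≼ = extends λ {z} e →
  keeps r≼ (trans (cong (value q) (⊖-negate-⊖ z l)) e)

shift-lattice-≼ : ∀ p i j → shift (i * + suc (width p) , j * + suc (height p)) p ≼ p
shift-lattice-≼ p i j = extends λ {z} e →
  trans (periodic p (congruent-sym (congruent-⊖-multiple z (∣n⇒∣m*n i ∣-refl) (∣n⇒∣m*n j ∣-refl)))) e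

-- Forcing

-- p ⊩ c at t : p forces t · x ∈ ⟦ c ⟧ for the generic point x; note (t · x) z = x (z ⊖ t).
infix 4 _⊩_at_

_⊩_at_ : Condition → BorelCode → ℤ² → Set
p ⊩ cyl z b at t = value p (z ⊖ t) ≡ just b
p ⊩ compl c at t = ∀ q → q ≼ p → ¬ q ⊩ c at t
p ⊩ union f at t = ∀ q → q ≼ p → ∃ λ r → r ≼ q × ∃ λ m → r ⊩ f m at t

⊩-mono : ∀ c {t p q} → q ≼ p → p ⊩ c at t → q ⊩ c at t
⊩-mono (cyl z b) q≼p p⊩ = keeps q≼p p⊩
⊩-mono (compl c) q≼p p⊩ = λ r r≼q → p⊩ r (≼-trans r≼q q≼p)
⊩-mono (union f) q≼p p⊩ = λ r r≼q → p⊩ r (≼-trans r≼q q≼p)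

mutual
  shift-⊩⇒⊩-⊕ : ∀ c {t l p} → shift l p ⊩ c at t → p ⊩ c at t ⊕ l
  shift-⊩⇒⊩-⊕ (cyl z b) {t} {l} {p} e = trans (cong (value p) (sym (⊖-⊖≡⊖-⊕ z t l))) e
  shift-⊩⇒⊩-⊕ (compl c) {t} {l} ⊩¬c r r≼p r⊩c =
    ⊩¬c (shift l r) (shift-mono r≼p) (⊩-⊕⇒shift-⊩ c {t} {l} r⊩c)
  shift-⊩⇒⊩-⊕ (union f) {t} {l} ⊩∪ q q≼p =
    let (r , r≼ , m , r⊩) = ⊩∪ (shift l q) (shift-mono q≼p) in
    shift (negate l) r , ≼-shift⇒shift-negate-≼ {l} {r} {q} r≼ , m ,
    shift-⊩⇒⊩-⊕ (f m) {t} {l} {shift (negate l) r} (⊩-mono (f m) {t} {r} (shift-negate-≼ {l} {r}) r⊩)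

  ⊩-⊕⇒shift-⊩ : ∀ c {t l p} → p ⊩ c at t ⊕ l → shift l p ⊩ c at t
  ⊩-⊕⇒shift-⊩ (cyl z b) {t} {l} {p} e = trans (cong (value p) (⊖-⊖≡⊖-⊕ z t l)) e
  ⊩-⊕⇒shift-⊩ (compl c) {t} {l} ⊩¬c q q≼ q⊩c =
    ⊩¬c (shift (negate l) q) (≼-shift⇒shift-negate-≼ q≼)
      (shift-⊩⇒⊩-⊕ c {t} {l} (⊩-mono c (shift-negate-≼ {l}) q⊩c))
  ⊩-⊕⇒shift-⊩ (union f) {t} {l} {p} ⊩∪ q q≼ =
    let (r , r≼ , m , r⊩) = ⊩∪ (shift (negate l) q) (≼-shift⇒shift-negate-≼ {l} {q} {p} q≼) in
    shift l r , ≼-trans (shift-mono {l} r≼) (shift-negate-≼ {l} {q}) , m , ⊩-⊕⇒shift-⊩ (f m) {t} {l} {r} r⊩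

⊩-periodic : ∀ c {t p} i j → p ⊩ c at t → p ⊩ c at latticePt t (suc (width p)) (suc (height p)) i j
⊩-periodic c {t} {p} i j p⊩ =
  shift-⊩⇒⊩-⊕ c {t} {i * + suc (width p) , j * + suc (height p)} {p} (⊩-mono c (shift-lattice-≼ p i j) p⊩)

Witnesses : Condition → BorelCode → ℤ² → Set
Witnesses p (cyl z b) t = p ⊩ cyl z b at t
Witnesses p (compl c) t = p ⊩ compl c at t
Witnesses p (union f) t = ∃ λ m → p ⊩ f m at t

witnesses⇒⊩ : ∀ c {t p} → Witnesses p c t → p ⊩ c at t
witnesses⇒⊩ (cyl z b) w = w
witnesses⇒⊩ (compl c) w = w
witnesses⇒⊩ (union f) (m , p⊩) = λ q q≼p → q , ≼-refl , m , ⊩-mono (f m) q≼p p⊩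

⊩⇒witnessed : ∀ c {t p} → p ⊩ c at t → ∃ λ q → q ≼ p × Witnesses q c t
⊩⇒witnessed (cyl z b) {p = p} p⊩ = p , ≼-refl , p⊩
⊩⇒witnessed (compl c) {p = p} p⊩ = p , ≼-refl , p⊩
⊩⇒witnessed (union f) {p = p} p⊩ = p⊩ p ≼-refl

Decides : ℤ² → BorelCode → Condition → Set
Decides t c q = Witnesses q c t ⊎ q ⊩ compl c at t

Dense : (Condition → Set) → Set
Dense D = ∀ p → ∃ λ q → q ≼ p × D q

decides-dense : ExcludedMiddle → ∀ t c → Dense (Decides t c)
decides-dense em t c p with em (∃ λ q → q ≼ p × Witnesses q c t)
... | inj₁ (q , q≼p , w) = q , q≼p , inj₁ w
... | inj₂ ¬w = p , ≼-refl , inj₂ λ q q≼p q⊩c →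
  let (r , r≼q , w) = ⊩⇒witnessed c {t} {q} q⊩c in ¬w (r , ≼-trans r≼q q≼p , w)

n<1+m+[1+n]*[1+m] : ∀ n m → n ℕ.< suc (m ℕ.+ suc n ℕ.* suc m)
n<1+m+[1+n]*[1+m] n m = ℕ.s≤s (ℕ.≤-trans (ℕ.n≤1+n n) (ℕ.≤-trans (ℕ.m≤m*n (suc n) (suc m)) (ℕ.m≤n+m _ m)))

-- Colour with b the cells of the coset of a, in the lattice refined by the factor 2 + N, where p is undefined.
-- The factor keeps the translates of a by nonzero vectors with coordinates at most N off the coset.
module Extension (p : Condition) (a : ℤ²) (b : Bool) (N : ℕ) where
  -- suc width′ is (2 + N) * suc (width p) by definition of ℕ._*_.
  width′ height′ : ℕ
  width′  = width p ℕ.+ suc N ℕ.* suc (width p)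
  height′ = height p ℕ.+ suc N ℕ.* suc (height p)

  OnCoset : ℤ² → Set
  OnCoset z = Congruent (suc width′) (suc height′) z a

  onCoset? : ∀ z → Dec (OnCoset z)
  onCoset? z = congruent? (suc width′) (suc height′) z a

  fill : Maybe Bool → Bool → Maybe Bool
  fill (just v) _     = just v
  fill nothing  true  = just b
  fill nothing  false = nothing

  value′ : ℤ² → Maybe Bool
  value′ z = fill (value p z) (does (onCoset? z))

  periodic′ : ∀ {z z′} → Congruent (suc width′) (suc height′) z z′ → value′ z ≡ value′ z′
  periodic′ {z} {z′} z≡z′ = cong₂ fill
    (periodic p (congruent-coarsen (suc (suc N)) (suc (suc N)) z≡z′))
    (does-⇔ (mk⇔ (congruent-trans (congruent-sym z≡z′)) (congruent-trans z≡z′)) (onCoset? z) (onCoset? z′))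

  off-coset : ∀ {z} → value p z ≡ nothing → ¬ OnCoset z → value′ z ≡ nothing
  off-coset {z} pz≡nothing ¬on = cong₂ fill pz≡nothing (dec-false (onCoset? z) ¬on)

  -- A cell of the coset has its neighbour one old period to the left off the coset.
  hole′ : ∃ λ c → value′ c ≡ nothing
  hole′ with hole p
  ... | h , ph≡nothing with onCoset? h
  ... | no ¬on = h , off-coset ph≡nothing ¬on
  ... | yes on = h ⊖ step , off-coset ph-step≡nothing ¬on
    where
    step : ℤ²
    step = + suc (width p) , 0ℤ
    h≡h-step : Congruent (suc (width p)) (suc (height p)) h (h ⊖ step)
    h≡h-step = congruent-⊖-multiple h ∣-refl (divides 0ℤ refl)
    ph-step≡nothing : value p (h ⊖ step) ≡ nothing
    ph-step≡nothing = trans (sym (periodic p h≡h-step)) ph≡nothing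
    ¬on : ¬ OnCoset (h ⊖ step)
    ¬on on′ with congruent-⊖-small h step (congruent-trans on (congruent-sym on′)) (ℕ.s≤s (ℕ.m<m+n _ ℕ.z<s)) ℕ.z<s
    ... | ()

  extended : Condition
  extended = record { width = width′ ; height = height′ ; value = value′ ; periodic = periodic′ ; hole = hole′ }

  extended-≼ : extended ≼ p
  extended-≼ = extends λ {z} pz≡just → cong (λ v → fill v (does (onCoset? z))) pz≡just

  extended-at : value p a ≡ nothing → value′ a ≡ just b
  extended-at pa≡nothing = cong₂ fill pa≡nothing (dec-true (onCoset? a) (congruent-refl a))

  N<suc[width′] : N ℕ.< suc width′
  N<suc[width′] = n<1+m+[1+n]*[1+m] N (width p)

  N<suc[height′] : N ℕ.< suc height′
  N<suc[height′] = n<1+m+[1+n]*[1+m] N (height p)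

DefinedAt : ℤ² → Condition → Set
DefinedAt z q = ∃ λ v → value q z ≡ just v

defined-dense : ∀ z → Dense (DefinedAt z)
defined-dense z p with value p z in pz
... | just v  = p , ≼-refl , v , pz
... | nothing = extended , extended-≼ , true , extended-at pz
  where open Extension p z true 0

Moves : ℤ² → Condition → Set
Moves g q = ∃ λ z → ∃ λ v → value q (z ⊖ g) ≡ just v × value q z ≡ just (not v)

moves-dense : ∀ {g} → g ≢ origin → Dense (Moves g)
moves-dense {g} g≢0 p with hole p
... | u , pu≡nothing with value p (u ⊖ g) in pu-g
... | just v = E.extended , E.extended-≼ , u , v ,
               keeps E.extended-≼ pu-g , E.extended-at pu≡nothing
  where module E = Extension p u (not v) 0
... | nothing = E₂.extended , ≼-trans E₂.extended-≼ E₁.extended-≼ , u , true ,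
                keeps E₂.extended-≼ (E₁.extended-at pu-g) , E₂.extended-at (E₁.off-coset pu≡nothing u∉)
  where
  N : ℕ
  N = ∣ proj₁ g ∣ ℕ.+ ∣ proj₂ g ∣
  module E₁ = Extension p (u ⊖ g) true N
  module E₂ = Extension E₁.extended u false 0
  u∉ : ¬ E₁.OnCoset u
  u∉ on = g≢0 (congruent-⊖-small u g on
    (ℕ.≤-<-trans (ℕ.m≤m+n _ _) E₁.N<suc[width′]) (ℕ.≤-<-trans (ℕ.m≤n+m _ _) E₁.N<suc[height′]))

Enumeration : Set → Set
Enumeration A = Σ (ℕ → A) λ e → ∀ a → ∃ λ n → e n ≡ a

enum-image : ∀ {A B : Set} → Enumeration A → (f : A → B) → (∀ b → ∃ λ a → f a ≡ b) → Enumeration B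
enum-image (e , e-onto) f f-onto = f ∘ e , λ b →
  let (a , fa≡b) = f-onto b ; (n , en≡a) = e-onto a in n , trans (cong f en≡a) fa≡b

next : ℕ × ℕ → ℕ × ℕ
next (zero  , j) = suc j , zero
next (suc i , j) = i , suc j

unpair : ℕ → ℕ × ℕ
unpair zero    = 0 , 0
unpair (suc n) = next (unpair n)

unpair-+ : ∀ k n {i j} → unpair n ≡ (k ℕ.+ i , j) → unpair (k ℕ.+ n) ≡ (i , k ℕ.+ j)
unpair-+ zero    n eq = eq
unpair-+ (suc k) n {i} {j} eq = begin
  unpair (suc k ℕ.+ n)     ≡⟨ cong unpair (sym (ℕ.+-suc k n)) ⟩
  unpair (k ℕ.+ suc n)     ≡⟨ unpair-+ k (suc n) (cong next eq) ⟩
  i , k ℕ.+ suc j          ≡⟨ cong (i ,_) (ℕ.+-suc k j) ⟩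
  i , suc k ℕ.+ j          ∎
  where open ≡-Reasoning

unpair-axis : ∀ s → ∃ λ n → unpair n ≡ (s , 0)
unpair-axis zero    = 0 , refl
unpair-axis (suc s) =
  let (n , eq) = unpair-axis s
      walked = unpair-+ s n (trans eq (cong (_, 0) (sym (ℕ.+-identityʳ s))))
  in suc (s ℕ.+ n) , trans (cong next walked) (cong (λ k → suc k , 0) (ℕ.+-identityʳ s))

unpair-onto : ∀ i j → ∃ λ n → unpair n ≡ (i , j)
unpair-onto i j =
  let (n , eq) = unpair-axis (j ℕ.+ i) in
  j ℕ.+ n , trans (unpair-+ j n eq) (cong (i ,_) (ℕ.+-identityʳ j))

enum-ℕ×ℕ : Enumeration (ℕ × ℕ)
enum-ℕ×ℕ = unpair , λ (i , j) → unpair-onto i j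

enum-× : ∀ {A B : Set} → Enumeration A → Enumeration B → Enumeration (A × B)
enum-× (e , e-onto) (e′ , e′-onto) = enum-image enum-ℕ×ℕ (λ (i , j) → e i , e′ j) λ (a , b) →
  let (i , ei≡a) = e-onto a ; (j , e′j≡b) = e′-onto b in (i , j) , cong₂ _,_ ei≡a e′j≡b

enum-ℕ : Enumeration ℕ
enum-ℕ = (λ n → n) , λ n → n , refl

enum-ℤ : Enumeration ℤ
enum-ℤ = enum-image enum-ℕ×ℕ (λ (m , n) → + m - + n) λ
  { (+ m)    → (m , 0) , ℤ.+-identityʳ (+ m)
  ; -[1+ m ] → (0 , suc m) , refl }

unpack : ℕ → ℕ → List ℕ
unpack zero    _ = []
unpack (suc k) c = proj₁ (unpair c) ∷ unpack k (proj₂ (unpair c))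

unpack-onto : ∀ xs → ∃ λ c → unpack (length xs) c ≡ xs
unpack-onto []       = 0 , refl
unpack-onto (x ∷ xs) =
  let (c , eq) = unpack-onto xs ; (n , unpair-n) = unpair-onto x c in
  n , trans (cong (λ (y , c′) → y ∷ unpack (length xs) c′) unpair-n) (cong (x ∷_) eq)

enum-List : Enumeration (List ℕ)
enum-List = enum-image enum-ℕ×ℕ (uncurry unpack) λ xs →
  let (c , eq) = unpack-onto xs in (length xs , c) , eq

-- The generic point

subcode : BorelCode → List ℕ → BorelCode
subcode c         []       = c
subcode (cyl z b) (_ ∷ _)  = cyl z b
subcode (compl c) (_ ∷ ps) = subcode c ps
subcode (union f) (m ∷ ps) = subcode (f m) ps

data Requirement : Set where
  decide   : ℤ² → List ℕ → Requirement
  define   : ℤ² → Requirement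
  separate : ℤ² → Requirement

enum-Requirement : Enumeration Requirement
enum-Requirement = enum-image (enum-× enum-ℕ (enum-× (enum-× enum-ℤ enum-ℤ) enum-List)) toRequirement λ
  { (decide t ps) → (0 , t , ps) , refl
  ; (define z)    → (1 , z , []) , refl
  ; (separate g)  → (2 , g , []) , refl }
  where
  toRequirement : ℕ × ℤ² × List ℕ → Requirement
  toRequirement (zero          , t , ps) = decide t ps
  toRequirement (suc zero      , z , _)  = define z
  toRequirement (suc (suc _)   , g , _)  = separate g

module Generic (em : ExcludedMiddle) (c₀ : BorelCode) where
  Meets : Requirement → Condition → Set
  Meets (decide t ps)  = Decides t (subcode c₀ ps)
  Meets (define z)     = DefinedAt z
  Meets (separate g) q = g ≢ origin → Moves g q

  meets-dense : ∀ r → Dense (Meets r)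
  meets-dense (decide t ps) = decides-dense em t (subcode c₀ ps)
  meets-dense (define z)    = defined-dense z
  meets-dense (separate g) p with ≡-dec ℤ._≟_ ℤ._≟_ g origin
  ... | yes refl = p , ≼-refl , λ g≢0 → ⊥-elim (g≢0 refl)
  ... | no g≢0   = let (q , q≼p , moves) = moves-dense g≢0 p in q , q≼p , λ _ → moves

  requirement : ℕ → Requirement
  requirement = proj₁ enum-Requirement

  generic : ℕ → Condition
  generic zero    = empty
  generic (suc n) = proj₁ (meets-dense (requirement n) (generic n))

  generic-meets : ∀ r → ∃ λ n → Meets r (generic n)
  generic-meets r =
    let (n , eq) = proj₂ enum-Requirement r in
    suc n , subst (λ r′ → Meets r′ (generic (suc n))) eq (proj₂ (proj₂ (meets-dense (requirement n) (generic n))))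

  generic-+ : ∀ k n → generic (k ℕ.+ n) ≼ generic n
  generic-+ zero    n = ≼-refl
  generic-+ (suc k) n = ≼-trans (proj₁ (proj₂ (meets-dense (requirement (k ℕ.+ n)) (generic (k ℕ.+ n))))) (generic-+ k n)

  generic-directed : ∀ n m → ∃ λ s → generic s ≼ generic n × generic s ≼ generic m
  generic-directed n m =
    m ℕ.+ n , generic-+ m n , subst (λ s → generic s ≼ generic m) (ℕ.+-comm n m) (generic-+ n m)

  x : Point
  x z = proj₁ (proj₂ (generic-meets (define z)))

  x-defined : ∀ z → ∃ λ n → value (generic n) z ≡ just (x z)
  x-defined z = let (n , _ , eq) = generic-meets (define z) in n , eq

  x-extends : ∀ {n z b} → value (generic n) z ≡ just b → x z ≡ b
  x-extends {n} {z} eq =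
    let (m , gm-z) = x-defined z ; (s , s≼n , s≼m) = generic-directed n m in
    just-injective (trans (sym (keeps s≼m gm-z)) (keeps s≼n eq))

  x-free : Free x
  x-free g g≢0 g·x≡x =
    let (n , moves) = generic-meets (separate g) ; (z , v , e₁ , e₂) = moves g≢0 in
    not-¬ (x-extends {n} e₁) (trans (g·x≡x z) (x-extends {n} e₂))

  Forced : BorelCode → ℤ² → Set
  Forced c t = ∃ λ n → generic n ⊩ c at t

  Decided : BorelCode → Set
  Decided c = ∀ ps t → ∃ λ n → Decides t (subcode c ps) (generic n)

  forced⇔holds : ∀ c → Decided c → ∀ t → Forced c t ⇔ ⟦ c ⟧ (t · x)
  forced⇔holds (cyl z b) _ t = mk⇔ (λ (n , e) → x-extends {n} e) λ x≡b →
    let (n , e) = x-defined (z ⊖ t) in n , trans e (cong just x≡b)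
  forced⇔holds (compl c) decided t = mk⇔ forced⇒¬holds ¬holds⇒forced
    where
    IH : Forced c t ⇔ ⟦ c ⟧ (t · x)
    IH = forced⇔holds c (λ ps → decided (0 ∷ ps)) t
    forced⇒¬holds : Forced (compl c) t → ¬ ⟦ c ⟧ (t · x)
    forced⇒¬holds (n , n⊩¬c) holds =
      let (m , m⊩c) = Equivalence.from IH holds ; (s , s≼n , s≼m) = generic-directed n m in
      n⊩¬c (generic s) s≼n (⊩-mono c s≼m m⊩c)
    ¬holds⇒forced : ¬ ⟦ c ⟧ (t · x) → Forced (compl c) t
    ¬holds⇒forced ¬holds with decided (0 ∷ []) t
    ... | n , inj₁ w     = ⊥-elim (¬holds (Equivalence.to IH (n , witnesses⇒⊩ c w)))
    ... | n , inj₂ n⊩¬c = n , n⊩¬c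
  forced⇔holds (union f) decided t = mk⇔ forced⇒holds holds⇒forced
    where
    IH : ∀ m → Forced (f m) t ⇔ ⟦ f m ⟧ (t · x)
    IH m = forced⇔holds (f m) (λ ps → decided (m ∷ ps)) t
    forced⇒holds : Forced (union f) t → ⟦ union f ⟧ (t · x)
    forced⇒holds (n , n⊩∪) with decided [] t
    ... | k , inj₁ (m , k⊩fm) = m , Equivalence.to (IH m) (k , k⊩fm)
    ... | k , inj₂ k⊩¬∪ =
      let (s , s≼k , s≼n) = generic-directed k n in
      ⊥-elim (k⊩¬∪ (generic s) s≼k (⊩-mono (union f) s≼n n⊩∪))
    holds⇒forced : ⟦ union f ⟧ (t · x) → Forced (union f) t
    holds⇒forced (m , holds) =
      let (n , n⊩fm) = Equivalence.from (IH m) holds in n , witnesses⇒⊩ (union f) (m , n⊩fm)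

theorem7p4 : ExcludedMiddle → (B : Point → Set) → IsBorel B → CompleteSection B →
    Σ Point λ x → Free x × Σ ℤ² λ k → Σ ℕ λ w → Σ ℕ λ h →
      ∀ (i j : ℤ) → B (latticePt k (suc w) (suc h) i j · x)
theorem7p4 em B (c₀ , B⇔c₀) (_ , meets-orbit) =
  let (g , g·x∈B) = meets-orbit x x-free
      (n , n⊩B)   = Equivalence.from (truth g) (proj₁ (B⇔c₀ (g · x)) g·x∈B)
  in x , x-free , g , width (generic n) , height (generic n) , λ i j →
     proj₂ (B⇔c₀ _) (Equivalence.to (truth _) (n , ⊩-periodic c₀ i j n⊩B))
  where
  open Generic em c₀
  truth : ∀ t → Forced c₀ t ⇔ ⟦ c₀ ⟧ (t · x)
  truth = forced⇔holds c₀ (λ ps t → generic-meets (decide t ps))
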